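{- Let $D$ be a $d$-regular expander digraph of order $k$, and let $P$ be an oriented path with $n$ edges, rooted in a leaf. For each $v\in V(D)$, if $X_0,\dots,X_n$ is a random $P$-walk $\mathcal{W}_{P,D}(v)$, then $$\max_{x\in V(D)}\Bigl(\mathbb{P}(X_n=x)-\frac1k\Bigr)^2\le\Bigl(1-\frac1{2k^3}\Bigr)^n.$$
   Context: A digraph is $d$-regular if every vertex has in- and outdegree $d$; it is an expander if $|N^-(S)|>|S|$ and $|N^+(S)|>|S|$ for all nonempty proper $S\subseteq V(D)$ (with $N^\pm(S)$ the union of out-/inneighbourhoods). Random $P$-walk: let $v_0,v_1,\dots,v_n$ be the vertices of $P$ in order from the root $v_0$. The walk $\mathcal{W}_{P,D}(v)$ is $X_0=v$ and, for $i=1,\dots,n$, $X_i$ is chosen uniformly at random from $N^+_D(X_{i-1})$ if $(v_{i-1},v_i)$ is an edge of $P$ and from $N^-_D(X_{i-1})$ otherwise, all choices independent. -}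

module Defs where

open import Data.Nat as ℕ using (ℕ; zero; suc)
open import Data.Integer using (+_)
open import Data.Bool using (Bool; true; false; _∧_; _∨_)
open import Data.Fin using (Fin; zero; suc)
open import Data.Fin.Subset using (Subset; ∣_∣; _∈_; _∉_; Nonempty)
open import Data.Vec using (Vec; []; _∷_; tabulate; lookup)
open import Data.Product using (∃; _×_)
open import Relation.Binary.PropositionalEquality using (_≡_) public
open import Data.Rational using (ℚ; 0ℚ; 1ℚ; _+_; _*_; _/_)

record Digraph (k : ℕ) : Set where
  field
    adj    : Fin k → Fin k → Bool
    noLoop : ∀ v → adj v v ≡ false

open Digraph public

anyFin : ∀ {k} → (Fin k → Bool) → Bool
anyFin {zero}  f = false
anyFin {suc k} f = f zero ∨ anyFin (λ i → f (suc i))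

sumFin : ∀ {k} → (Fin k → ℚ) → ℚ
sumFin {zero}  f = 0ℚ
sumFin {suc k} f = f zero + sumFin (λ i → f (suc i))

outN : ∀ {k} → Digraph k → Fin k → Subset k
outN D u = tabulate (λ v → adj D u v)

inN : ∀ {k} → Digraph k → Fin k → Subset k
inN D u = tabulate (λ v → adj D v u)

outNS : ∀ {k} → Digraph k → Subset k → Subset k
outNS D S = tabulate (λ v → anyFin (λ u → lookup S u ∧ adj D u v))

inNS : ∀ {k} → Digraph k → Subset k → Subset k
inNS D S = tabulate (λ v → anyFin (λ u → lookup S u ∧ adj D v u))

Regular : ∀ {k} → ℕ → Digraph k → Set
Regular d D = ∀ v → (∣ outN D v ∣ ≡ d) × (∣ inN D v ∣ ≡ d)

Expander : ∀ {k} → Digraph k → Set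
Expander {k} D = ∀ (S : Subset k) → Nonempty S → (∃ λ v → v ∉ S) →
  (∣ S ∣ ℕ.< ∣ inNS D S ∣) × (∣ S ∣ ℕ.< ∣ outNS D S ∣)

-- 1/n as a rational (value 0 at n = 0; only used at nonzero n)
inv : ℕ → ℚ
inv zero    = 0ℚ
inv (suc n) = + 1 / suc n

ind : Bool → ℚ
ind true  = 1ℚ
ind false = 0ℚ

δ : ∀ {k} → Fin k → Fin k → ℚ
δ {suc k} zero    zero    = 1ℚ
δ {suc k} zero    (suc _) = 0ℚ
δ {suc k} (suc _) zero    = 0ℚ
δ {suc k} (suc i) (suc j) = δ i j

-- An oriented path P with n edges rooted in a leaf v₀, with vertices
-- v₀,…,vₙ in order from the root, is encoded by its edge directions:
-- entry i is true iff (v_{i-1}, v_i) is an edge of P (forward), false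
-- iff (v_i, v_{i-1}) is an edge of P.
OrientedPath : ℕ → Set
OrientedPath n = Vec Bool n

-- walkProb D P v x = ℙ(Xₙ = x) for the random P-walk 𝒲_{P,D}(v):
-- first step goes to a uniformly random out-neighbour (forward edge) or
-- in-neighbour (backward edge) u of v, then continues as the walk for the
-- rest of P started at u.
walkProb : ∀ {k n} → Digraph k → OrientedPath n → Fin k → Fin k → ℚ
walkProb D []            v x = δ v x
walkProb D (true  ∷ dir) v x =
  sumFin (λ u → ind (adj D v u) * inv ∣ outN D v ∣ * walkProb D dir u x)
walkProb D (false ∷ dir) v x =
  sumFin (λ u → ind (adj D u v) * inv ∣ inN D v ∣ * walkProb D dir u x)

_^ℚ_ : ℚ → ℕ → ℚ
q ^ℚ zero  = 1ℚ
q ^ℚ suc n = q * (q ^ℚ n)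

module Submission where

-- Let c = 1/k and let h be the deviation ℙ(X_i = ·) - c of the walk after i steps, so Σ h = 0.
-- A forward step replaces h by its average g over out-neighbours; a backward step is a forward
-- step in the transpose. The transition matrix of a d-regular digraph is doubly stochastic, so
-- Σ g = Σ h and Σ h² - Σ g² = (1/d) Σ_{v→u} (h u - g v)². Starting from S = {argmax h} and T = ∅
-- and repeatedly adding the endpoint of an edge from outside T into S, or from T to outside S
-- (expansion guarantees one exists), argmin h is reached within 2k edges; along the way
-- Cauchy-Schwarz gives (max h - min h)² ≤ 2k Σ_{v→u} (h u - g v)². As Σ h = 0 we also have
-- Σ h² ≤ k (max h - min h)², and with d ≤ k this yields Σ g² ≤ (1 - 1/(2k³)) Σ h².
-- Induction along P from Σ h₀² ≤ 1 bounds Σ h², hence each single h(x)².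

module _ where

  open import Algebra.Bundles using (CommutativeMonoid; CommutativeRing)
  import Algebra.Properties.Semiring.Mult as Mult
  import Data.Bool as Bool
  open import Data.Bool using (Bool; true; false; _∨_; _∧_)
  open import Data.Bool.Properties using (∧-conicalˡ; ∧-conicalʳ)
  open import Data.Fin using (Fin; zero; suc)
  open import Data.Fin.Properties using (any?)
  open import Data.Fin.Subset using (Subset; ∣_∣; _∈_; _∉_; _⊆_; _∪_; ⁅_⁆) renaming (⊥ to ∅)
  open import Data.Fin.Subset.Properties
    using (_∈?_; nonempty?; Empty-unique; x∈⁅x⁆; x∈⁅y⁆⇒x≡y; ∉⊥; x∈p∪q⁻; x∈p∪q⁺; p⊆p∪q;
           ∣⊥∣≡0; ∣⁅x⁆∣≡1; ∣p∣≤n; p⊆q⇒∣p∣≤∣q∣; p⊂q⇒∣p∣<∣q∣)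
  import Data.Integer as ℤ
  open import Data.List using (allFin)
  import Data.List.Extrema
  open import Data.List.Membership.Propositional.Properties using (∈-allFin)
  import Data.List.Relation.Unary.All as All
  open import Data.Integer.Tactic.RingSolver using (solve-∀)
  import Data.Nat.Solver as ℕ-Solver
  import Data.Nat.Coprimality as Coprime
  open import Data.Nat as ℕ using (ℕ; zero; suc)
  import Data.Nat.Properties as ℕ
  open import Data.Product using (_,_; ∃; _×_; proj₁; proj₂; swap)
  open import Data.Rational renaming (∣_∣ to ∣_∣ℚ)
  open import Data.Rational.Properties
  open import Data.Rational.Solver using (module +-*-Solver)
  import Data.Rational.Unnormalised as ℚᵘ
  import Data.Rational.Unnormalised.Properties as ℚᵘ
  open import Data.Sum using (_⊎_; inj₁; inj₂)
  open import Data.Empty using (⊥; ⊥-elim)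
  open import Data.Vec using ([]; _∷_; tabulate; lookup)
  open import Data.Vec.Properties using (lookup-zipWith; lookup-replicate; lookup∘tabulate; []=⇒lookup; lookup⇒[]=)
  open import Relation.Binary.Bundles using (DecTotalOrder)
  open import Relation.Binary.PropositionalEquality
  open import Relation.Nullary using (Dec; yes; no; ¬_; ¬?; contradiction)
  open import Relation.Nullary.Decidable using (decidable-stable; _×-dec_; _⊎-dec_)
  open import Defs
    using (Digraph; adj; noLoop; inN; outN; inNS; outNS; Regular; Expander;
           anyFin; sumFin; ind; δ; inv; _^ℚ_; OrientedPath; walkProb)
  module Extrema = Data.List.Extrema (DecTotalOrder.totalOrder ≤-decTotalOrder)
  open +-*-Solver using (solve; _:+_; _:*_; _:-_; :-_; _:=_; con)
  open CommutativeRing +-*-commutativeRing using (semiring)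
  open CommutativeMonoid +-0-commutativeMonoid using (commutativeSemigroup)
  open import Algebra.Properties.CommutativeSemigroup commutativeSemigroup using (interchange)
  open Mult semiring using (×-homo-+; ×1-homo-*) renaming (_×_ to _×ℚ_)

  p≤q⇒0≤q-p : ∀ {p q} → p ≤ q → 0ℚ ≤ q - p
  p≤q⇒0≤q-p {p} {q} p≤q = subst (_≤ q - p) (+-inverseʳ p) (+-monoˡ-≤ (- p) p≤q)

  0≤q-p⇒p≤q : ∀ {p q} → 0ℚ ≤ q - p → p ≤ q
  0≤q-p⇒p≤q {p} {q} 0≤q-p =
    subst₂ _≤_ (+-identityʳ p) (solve 2 (λ p q → p :+ (q :- p) := q) refl p q) (+-monoʳ-≤ p 0≤q-p)

  *-monoˡ-≤-0≤ : ∀ {r p q} → 0ℚ ≤ r → p ≤ q → r * p ≤ r * q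
  *-monoˡ-≤-0≤ {r} 0≤r = *-monoˡ-≤-nonNeg r {{nonNegative 0≤r}}

  *-monoʳ-≤-0≤ : ∀ {r p q} → 0ℚ ≤ r → p ≤ q → p * r ≤ q * r
  *-monoʳ-≤-0≤ {r} 0≤r = *-monoʳ-≤-nonNeg r {{nonNegative 0≤r}}

  0≤p*q : ∀ {p q} → 0ℚ ≤ p → 0ℚ ≤ q → 0ℚ ≤ p * q
  0≤p*q {p} 0≤p 0≤q = subst (_≤ p * _) (*-zeroʳ p) (*-monoˡ-≤-0≤ 0≤p 0≤q)

  *-mono-≤-0≤ : ∀ {p q r s} → 0ℚ ≤ q → 0ℚ ≤ r → p ≤ q → r ≤ s → p * r ≤ q * s
  *-mono-≤-0≤ 0≤q 0≤r p≤q r≤s = ≤-trans (*-monoʳ-≤-0≤ 0≤r p≤q) (*-monoˡ-≤-0≤ 0≤q r≤s)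

  p≤q⇒p*p≤q*q : ∀ {p q} → 0ℚ ≤ p → p ≤ q → p * p ≤ q * q
  p≤q⇒p*p≤q*q 0≤p p≤q = *-mono-≤-0≤ (≤-trans 0≤p p≤q) 0≤p p≤q p≤q

  p≤p+q : ∀ {p q} → 0ℚ ≤ q → p ≤ p + q
  p≤p+q {p} 0≤q = subst (_≤ p + _) (+-identityʳ p) (+-monoʳ-≤ p 0≤q)

  ∣p∣*∣p∣≡p*p : ∀ p → ∣ p ∣ℚ * ∣ p ∣ℚ ≡ p * p
  ∣p∣*∣p∣≡p*p p with ∣p∣≡p∨∣p∣≡-p p
  ... | inj₁ ∣p∣≡p  rewrite ∣p∣≡p  = refl
  ... | inj₂ ∣p∣≡-p rewrite ∣p∣≡-p = solve 1 (λ p → (:- p) :* (:- p) := p :* p) refl p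

  0≤p*p : ∀ p → 0ℚ ≤ p * p
  0≤p*p p = subst (0ℚ ≤_) (∣p∣*∣p∣≡p*p p) (0≤p*q (0≤∣p∣ p) (0≤∣p∣ p))

  p≤∣p∣ : ∀ p → p ≤ ∣ p ∣ℚ
  p≤∣p∣ p with ∣p∣≡p∨∣p∣≡-p p
  ... | inj₁ ∣p∣≡p  = ≤-reflexive (sym ∣p∣≡p)
  ... | inj₂ ∣p∣≡-p = 0≤q-p⇒p≤q (subst (λ z → 0ℚ ≤ ∣ p ∣ℚ + z) ∣p∣≡-p (+-mono-≤ (0≤∣p∣ p) (0≤∣p∣ p)))

  *-distribˡ-sub : ∀ p q r → p * (q - r) ≡ p * q - p * r
  *-distribˡ-sub = solve 3 (λ p q r → p :* (q :- r) := p :* q :- p :* r) refl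

  telescope : ∀ p q r → (p - q) + (q - r) ≡ p - r
  telescope = solve 3 (λ p q r → (p :- q) :+ (q :- r) := p :- r) refl

  ∣q-p∣≡∣p-q∣ : ∀ p q → ∣ q - p ∣ℚ ≡ ∣ p - q ∣ℚ
  ∣q-p∣≡∣p-q∣ p q = trans (cong ∣_∣ℚ (solve 2 (λ p q → q :- p := :- (p :- q)) refl p q)) (∣-p∣≡∣p∣ (p - q))

  fromℕ : ℕ → ℚ
  fromℕ n = n ×ℚ 1ℚ

  fromℕ-+ : ∀ m n → fromℕ (m ℕ.+ n) ≡ fromℕ m + fromℕ n
  fromℕ-+ m n = ×-homo-+ 1ℚ m n

  fromℕ-* : ∀ m n → fromℕ (m ℕ.* n) ≡ fromℕ m * fromℕ n
  fromℕ-* = ×1-homo-*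

  0≤fromℕ : ∀ n → 0ℚ ≤ fromℕ n
  0≤fromℕ zero    = ≤-refl
  0≤fromℕ (suc n) = +-mono-≤ (<⇒≤ (positive⁻¹ 1ℚ)) (0≤fromℕ n)

  fromℕ-mono-≤ : ∀ {m n} → m ℕ.≤ n → fromℕ m ≤ fromℕ n
  fromℕ-mono-≤ {m} m≤n with ℕ.m≤n⇒∃[o]m+o≡n m≤n
  ... | o , refl = subst (fromℕ m ≤_) (sym (fromℕ-+ m o)) (p≤p+q (0≤fromℕ o))

  fromℕ-pos : ∀ n → 0ℚ < fromℕ (suc n)
  fromℕ-pos n = <-≤-trans (positive⁻¹ 1ℚ) (p≤p+q (0≤fromℕ n))

  -- inv n normalises 1 / n, so fromℕ n is compared with the literal n/1, whose inverse is inv n.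
  private
    n/1 : ℕ → ℚ
    n/1 n = mkℚ (ℤ.+ n) 0 (Coprime.sym (Coprime.1-coprimeTo n))

    fromℕ≡n/1 : ∀ n → fromℕ n ≡ n/1 n
    fromℕ≡n/1 zero    = refl
    fromℕ≡n/1 (suc n) rewrite fromℕ≡n/1 n =
      toℚᵘ-injective (ℚᵘ.≃-trans (toℚᵘ-homo-+ 1ℚ (n/1 n)) (ℚᵘ.*≡* (cross-multiplied (ℤ.+ n))))
      where
      cross-multiplied : ∀ x → (ℤ.+ 1 ℤ.* ℤ.+ 1 ℤ.+ x ℤ.* ℤ.+ 1) ℤ.* ℤ.+ 1 ≡ (ℤ.+ 1 ℤ.+ x) ℤ.* (ℤ.+ 1 ℤ.* ℤ.+ 1)
      cross-multiplied = solve-∀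

  fromℕ*inv : ∀ n → .{{ℕ.NonZero n}} → fromℕ n * inv n ≡ 1ℚ
  fromℕ*inv (suc n) rewrite fromℕ≡n/1 (suc n) | normalize-coprime {1} {n} (Coprime.1-coprimeTo (suc n)) =
    *-inverseʳ (n/1 (suc n))

  0≤inv : ∀ n → 0ℚ ≤ inv n
  0≤inv zero    = ≤-refl
  0≤inv (suc n) = nonNegative⁻¹ (inv (suc n)) {{normalize-nonNeg 1 (suc n)}}

  inv≤1 : ∀ n → inv n ≤ 1ℚ
  inv≤1 zero    = <⇒≤ (positive⁻¹ 1ℚ)
  inv≤1 (suc n) = begin
    inv (suc n)                    ≡⟨ sym (*-identityˡ (inv (suc n))) ⟩
    1ℚ * inv (suc n)               ≤⟨ *-monoʳ-≤-0≤ (0≤inv (suc n)) (fromℕ-mono-≤ (ℕ.s≤s (ℕ.z≤n {n}))) ⟩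
    fromℕ (suc n) * inv (suc n)    ≡⟨ fromℕ*inv (suc n) ⟩
    1ℚ                             ∎
    where open ≤-Reasoning

  m*d≤K⇒m/K≤1/d : ∀ {m d K} .{{_ : ℕ.NonZero d}} .{{_ : ℕ.NonZero K}} → m ℕ.* d ℕ.≤ K → inv K * fromℕ m ≤ inv d
  m*d≤K⇒m/K≤1/d {m} {d} {K} md≤K = begin
    inv K * fromℕ m                          ≡⟨ sym (*-identityʳ _) ⟩
    inv K * fromℕ m * 1ℚ                     ≡⟨ cong (inv K * fromℕ m *_) (sym (fromℕ*inv d)) ⟩
    inv K * fromℕ m * (fromℕ d * inv d)      ≡⟨ solve 4 (λ i m d j → i :* m :* (d :* j) := i :* (m :* d) :* j) refl
                                                         (inv K) (fromℕ m) (fromℕ d) (inv d) ⟩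
    inv K * (fromℕ m * fromℕ d) * inv d      ≡⟨ cong (λ z → inv K * z * inv d) (sym (fromℕ-* m d)) ⟩
    inv K * fromℕ (m ℕ.* d) * inv d          ≤⟨ *-monoʳ-≤-0≤ (0≤inv d) (*-monoˡ-≤-0≤ (0≤inv K) (fromℕ-mono-≤ md≤K)) ⟩
    inv K * fromℕ K * inv d                  ≡⟨ cong (_* inv d) (trans (*-comm (inv K) (fromℕ K)) (fromℕ*inv K)) ⟩
    1ℚ * inv d                               ≡⟨ *-identityˡ (inv d) ⟩
    inv d                                    ∎
    where open ≤-Reasoning

  sum-cong : ∀ {k} {f g : Fin k → ℚ} → (∀ i → f i ≡ g i) → sumFin f ≡ sumFin g
  sum-cong {zero}  f≗g = refl
  sum-cong {suc k} f≗g = cong₂ _+_ (f≗g zero) (sum-cong (λ i → f≗g (suc i)))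

  sum-distrib-+ : ∀ {k} (f g : Fin k → ℚ) → sumFin (λ i → f i + g i) ≡ sumFin f + sumFin g
  sum-distrib-+ {zero}  f g = refl
  sum-distrib-+ {suc k} f g rewrite sum-distrib-+ (λ i → f (suc i)) (λ i → g (suc i)) =
    interchange (f zero) (g zero) _ _

  *-distribˡ-sum : ∀ {k} c (f : Fin k → ℚ) → c * sumFin f ≡ sumFin (λ i → c * f i)
  *-distribˡ-sum {zero}  c f = *-zeroʳ c
  *-distribˡ-sum {suc k} c f rewrite sym (*-distribˡ-sum c (λ i → f (suc i))) = *-distribˡ-+ c (f zero) _

  *-distribʳ-sum : ∀ {k} c (f : Fin k → ℚ) → sumFin f * c ≡ sumFin (λ i → f i * c)
  *-distribʳ-sum c f =
    trans (*-comm _ c) (trans (*-distribˡ-sum c f) (sum-cong (λ i → *-comm c (f i))))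

  sum-const : ∀ {k} c → sumFin {k} (λ _ → c) ≡ fromℕ k * c
  sum-const {zero}  c = sym (*-zeroˡ c)
  sum-const {suc k} c rewrite sum-const {k} c =
    trans (cong (_+ fromℕ k * c) (sym (*-identityˡ c))) (sym (*-distribʳ-+ c 1ℚ (fromℕ k)))

  sum-zero : ∀ {k} → sumFin {k} (λ _ → 0ℚ) ≡ 0ℚ
  sum-zero {k} = trans (sum-const {k} 0ℚ) (*-zeroʳ (fromℕ k))

  sum-distrib-neg : ∀ {k} (f : Fin k → ℚ) → sumFin (λ i → - f i) ≡ - sumFin f
  sum-distrib-neg {zero}  f = refl
  sum-distrib-neg {suc k} f rewrite sum-distrib-neg (λ i → f (suc i)) = sym (neg-distrib-+ (f zero) _)

  sum-distrib-sub : ∀ {k} (f g : Fin k → ℚ) → sumFin (λ i → f i - g i) ≡ sumFin f - sumFin g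
  sum-distrib-sub f g = trans (sum-distrib-+ f (λ i → - g i)) (cong (sumFin f +_) (sum-distrib-neg g))

  sum-comm : ∀ {k l} (f : Fin k → Fin l → ℚ) →
             sumFin (λ i → sumFin (f i)) ≡ sumFin (λ j → sumFin (λ i → f i j))
  sum-comm {zero}  {l} f = sym (sum-zero {l})
  sum-comm {suc k} {l} f rewrite sum-comm (λ i → f (suc i)) =
    sym (sum-distrib-+ (f zero) (λ j → sumFin (λ i → f (suc i) j)))

  sum-mono-≤ : ∀ {k} {f g : Fin k → ℚ} → (∀ i → f i ≤ g i) → sumFin f ≤ sumFin g
  sum-mono-≤ {zero}  f≤g = ≤-refl
  sum-mono-≤ {suc k} f≤g = +-mono-≤ (f≤g zero) (sum-mono-≤ (λ i → f≤g (suc i)))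

  0≤sum : ∀ {k} {f : Fin k → ℚ} → (∀ i → 0ℚ ≤ f i) → 0ℚ ≤ sumFin f
  0≤sum {k} {f} 0≤f = subst (_≤ sumFin f) (sum-zero {k}) (sum-mono-≤ 0≤f)

  term≤sum : ∀ {k} {f : Fin k → ℚ} → (∀ i → 0ℚ ≤ f i) → ∀ j → f j ≤ sumFin f
  term≤sum {suc k} {f} 0≤f zero    = p≤p+q (0≤sum (λ i → 0≤f (suc i)))
  term≤sum {suc k} {f} 0≤f (suc j) =
    subst (_≤ sumFin f) (+-identityˡ (f (suc j))) (+-mono-≤ (0≤f zero) (term≤sum (λ i → 0≤f (suc i)) j))

  0≤ind : ∀ b → 0ℚ ≤ ind b
  0≤ind true  = <⇒≤ (positive⁻¹ 1ℚ)
  0≤ind false = ≤-refl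

  ind*p≤p : ∀ b {p} → 0ℚ ≤ p → ind b * p ≤ p
  ind*p≤p true  {p} _   = ≤-reflexive (*-identityˡ p)
  ind*p≤p false {p} 0≤p = subst (_≤ p) (sym (*-zeroˡ p)) 0≤p

  ind-∨ : ∀ {a b} → (a ≡ true → b ≡ false) → ind (a ∨ b) ≡ ind a + ind b
  ind-∨ {true}  {false} _ = refl
  ind-∨ {true}  {true}  a⇒¬b with a⇒¬b refl
  ... | ()
  ind-∨ {false} {b}     _ = sym (+-identityˡ (ind b))

  sum-ind : ∀ {k} (b : Fin k → Bool) → sumFin (λ i → ind (b i)) ≡ fromℕ ∣ tabulate b ∣
  sum-ind {zero}  b = refl
  sum-ind {suc k} b with b zero | sum-ind (λ i → b (suc i))
  ... | true  | ih = cong (1ℚ +_) ih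
  ... | false | ih = trans (+-identityˡ _) ih

  δ-idem : ∀ {k} (u x : Fin k) → δ u x * δ u x ≡ δ u x
  δ-idem zero    zero    = refl
  δ-idem zero    (suc x) = refl
  δ-idem (suc u) zero    = refl
  δ-idem (suc u) (suc x) = δ-idem u x

  ind-⁅⁆ : ∀ {k} (x u : Fin k) → ind (lookup ⁅ x ⁆ u) ≡ δ u x
  ind-⁅⁆ zero    zero    = refl
  ind-⁅⁆ zero    (suc u) = cong ind (lookup-replicate u false)
  ind-⁅⁆ (suc x) zero    = refl
  ind-⁅⁆ (suc x) (suc u) = ind-⁅⁆ x u

  sum-δ : ∀ {k} (x : Fin k) (f : Fin k → ℚ) → sumFin (λ u → δ u x * f u) ≡ f x
  sum-δ {suc k} zero    f = begin
    1ℚ * f zero + sumFin (λ i → 0ℚ * f (suc i)) ≡⟨ cong₂ _+_ (*-identityˡ (f zero)) (sum-cong (λ i → *-zeroˡ (f (suc i)))) ⟩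
    f zero + sumFin {k} (λ _ → 0ℚ)              ≡⟨ cong (f zero +_) (sum-zero {k}) ⟩
    f zero + 0ℚ                                 ≡⟨ +-identityʳ (f zero) ⟩
    f zero                                      ∎
    where open ≡-Reasoning
  sum-δ {suc k} (suc x) f =
    trans (cong₂ _+_ (*-zeroˡ (f zero)) (sum-δ x (λ i → f (suc i)))) (+-identityˡ (f (suc x)))

  sumOver : ∀ {k} → Subset k → (Fin k → ℚ) → ℚ
  sumOver S f = sumFin (λ u → ind (lookup S u) * f u)

  module _ {k} {f : Fin k → ℚ} (0≤f : ∀ u → 0ℚ ≤ f u) where

    0≤sumOver : ∀ S → 0ℚ ≤ sumOver S f
    0≤sumOver S = 0≤sum (λ u → 0≤p*q (0≤ind (lookup S u)) (0≤f u))

    sumOver≤sum : ∀ S → sumOver S f ≤ sumFin f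
    sumOver≤sum S = sum-mono-≤ (λ u → ind*p≤p (lookup S u) (0≤f u))

    term≤sumOver : ∀ {S x} → x ∈ S → f x ≤ sumOver S f
    term≤sumOver {S} {x} x∈S =
      subst (_≤ sumOver S f) x-term≡fx (term≤sum (λ u → 0≤p*q (0≤ind (lookup S u)) (0≤f u)) x)
      where
      x-term≡fx : ind (lookup S x) * f x ≡ f x
      x-term≡fx = trans (cong (λ b → ind b * f x) ([]=⇒lookup x∈S)) (*-identityˡ (f x))

  sumOver-distrib-+ : ∀ {k} S (f g : Fin k → ℚ) →
                      sumOver S (λ u → f u + g u) ≡ sumOver S f + sumOver S g
  sumOver-distrib-+ S f g =
    trans (sum-cong (λ u → *-distribˡ-+ (ind (lookup S u)) (f u) (g u)))
          (sum-distrib-+ (λ u → ind (lookup S u) * f u) (λ u → ind (lookup S u) * g u))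

  ind-∪⁅⁆ : ∀ {k} {S : Subset k} {x} → x ∉ S → ∀ u →
            ind (lookup (S ∪ ⁅ x ⁆) u) ≡ ind (lookup S u) + δ u x
  ind-∪⁅⁆ {S = S} {x} x∉S u = begin
    ind (lookup (S ∪ ⁅ x ⁆) u)             ≡⟨ cong ind (lookup-zipWith _∨_ u S ⁅ x ⁆) ⟩
    ind (lookup S u ∨ lookup ⁅ x ⁆ u)      ≡⟨ ind-∨ disjoint ⟩
    ind (lookup S u) + ind (lookup ⁅ x ⁆ u) ≡⟨ cong (ind (lookup S u) +_) (ind-⁅⁆ x u) ⟩
    ind (lookup S u) + δ u x               ∎
    where
    open ≡-Reasoning
    disjoint : lookup S u ≡ true → lookup ⁅ x ⁆ u ≡ false
    disjoint u∈S with lookup ⁅ x ⁆ u in u∈⁅x⁆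
    ... | false = refl
    ... | true with x∈⁅y⁆⇒x≡y x (lookup⇒[]= u ⁅ x ⁆ u∈⁅x⁆)
    ... | refl = contradiction (lookup⇒[]= u S u∈S) x∉S

  sumOver-∪⁅⁆ : ∀ {k} {S : Subset k} {x} → x ∉ S → ∀ f → sumOver (S ∪ ⁅ x ⁆) f ≡ sumOver S f + f x
  sumOver-∪⁅⁆ {S = S} {x} x∉S f = begin
    sumOver (S ∪ ⁅ x ⁆) f                                  ≡⟨ sum-cong (λ u → cong (_* f u) (ind-∪⁅⁆ x∉S u)) ⟩
    sumFin (λ u → (ind (lookup S u) + δ u x) * f u)         ≡⟨ sum-cong (λ u → *-distribʳ-+ (f u) (ind (lookup S u)) (δ u x)) ⟩
    sumFin (λ u → ind (lookup S u) * f u + δ u x * f u)     ≡⟨ sum-distrib-+ (λ u → ind (lookup S u) * f u) (λ u → δ u x * f u) ⟩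
    sumOver S f + sumFin (λ u → δ u x * f u)               ≡⟨ cong (sumOver S f +_) (sum-δ x f) ⟩
    sumOver S f + f x                                      ∎
    where open ≡-Reasoning

  ∈∪⁅⁆⇒ : ∀ {k} {S : Subset k} {x y} → y ∈ S ∪ ⁅ x ⁆ → y ∈ S ⊎ y ≡ x
  ∈∪⁅⁆⇒ {S = S} {x} y∈ with x∈p∪q⁻ S ⁅ x ⁆ y∈
  ... | inj₁ y∈S   = inj₁ y∈S
  ... | inj₂ y∈⁅x⁆ = inj₂ (x∈⁅y⁆⇒x≡y x y∈⁅x⁆)

  ∣p∣<∣p∪⁅x⁆∣ : ∀ {k} {S : Subset k} {x} → x ∉ S → ∣ S ∣ ℕ.< ∣ S ∪ ⁅ x ⁆ ∣
  ∣p∣<∣p∪⁅x⁆∣ {S = S} {x} x∉S = p⊂q⇒∣p∣<∣q∣ (p⊆p∪q ⁅ x ⁆ , x , x∈p∪q⁺ (inj₂ (x∈⁅x⁆ x)) , x∉S)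

  -- Averaging by a doubly stochastic matrix

  average : ∀ {k} → (Fin k → Fin k → ℚ) → (Fin k → ℚ) → Fin k → ℚ
  average α f v = sumFin (λ u → α v u * f u)

  module DoublyStochastic {k} (α : Fin k → Fin k → ℚ)
    (rowSum : ∀ v → sumFin (α v) ≡ 1ℚ) (colSum : ∀ u → sumFin (λ v → α v u) ≡ 1ℚ) where

    average-const : ∀ c v → average α (λ _ → c) v ≡ c
    average-const c v = trans (sym (*-distribʳ-sum c (α v))) (trans (cong (_* c) (rowSum v)) (*-identityˡ c))

    average-shift : ∀ f c v → average α (λ u → f u - c) v ≡ average α f v - c
    average-shift f c v = begin
      sumFin (λ u → α v u * (f u - c))          ≡⟨ sum-cong (λ u → *-distribˡ-sub (α v u) (f u) c) ⟩
      sumFin (λ u → α v u * f u - α v u * c)    ≡⟨ sum-distrib-sub (λ u → α v u * f u) (λ u → α v u * c) ⟩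
      average α f v - average α (λ _ → c) v     ≡⟨ cong (λ z → average α f v - z) (average-const c v) ⟩
      average α f v - c                         ∎
      where open ≡-Reasoning

    sum-average : ∀ h → sumFin (average α h) ≡ sumFin h
    sum-average h = begin
      sumFin (λ v → sumFin (λ u → α v u * h u)) ≡⟨ sum-comm (λ v u → α v u * h u) ⟩
      sumFin (λ u → sumFin (λ v → α v u * h u)) ≡⟨ sum-cong (λ u → sym (*-distribʳ-sum (h u) (λ v → α v u))) ⟩
      sumFin (λ u → sumFin (λ v → α v u) * h u) ≡⟨ sum-cong (λ u → trans (cong (_* h u) (colSum u)) (*-identityˡ (h u))) ⟩
      sumFin h                                  ∎
      where open ≡-Reasoning

    module _ (h : Fin k → ℚ) where

      private
        m : Fin k → ℚ
        m = average α h

      row-variance : ∀ v → sumFin (λ u → α v u * ((h u - m v) * (h u - m v))) ≡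
                           average α (λ u → h u * h u) v - m v * m v
      row-variance v = begin
        sumFin (λ u → α v u * ((h u - m v) * (h u - m v)))
          ≡⟨ sum-cong (λ u → expand (α v u) (h u) (m v)) ⟩
        sumFin (λ u → (α v u * (h u * h u) + - (m v + m v) * (α v u * h u)) + m v * m v * α v u)
          ≡⟨ sum-distrib-+ (λ u → α v u * (h u * h u) + - (m v + m v) * (α v u * h u)) (λ u → m v * m v * α v u) ⟩
        sumFin (λ u → α v u * (h u * h u) + - (m v + m v) * (α v u * h u)) + sumFin (λ u → m v * m v * α v u)
          ≡⟨ cong₂ _+_ (sum-distrib-+ (λ u → α v u * (h u * h u)) (λ u → - (m v + m v) * (α v u * h u)))
                       (sym (*-distribˡ-sum (m v * m v) (α v))) ⟩
        average α (λ u → h u * h u) v + sumFin (λ u → - (m v + m v) * (α v u * h u)) + m v * m v * sumFin (α v)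
          ≡⟨ cong₂ (λ s r → average α (λ u → h u * h u) v + s + m v * m v * r)
                   (sym (*-distribˡ-sum (- (m v + m v)) (λ u → α v u * h u))) (rowSum v) ⟩
        average α (λ u → h u * h u) v + - (m v + m v) * m v + m v * m v * 1ℚ
          ≡⟨ solve 2 (λ s y → s :+ :- (y :+ y) :* y :+ y :* y :* con 1ℚ := s :- y :* y) refl (average α (λ u → h u * h u) v) (m v) ⟩
        average α (λ u → h u * h u) v - m v * m v
          ∎
        where
        open ≡-Reasoning
        expand : ∀ a x y → a * ((x - y) * (x - y)) ≡ (a * (x * x) + - (y + y) * (a * x)) + y * y * a
        expand = solve 3 (λ a x y → a :* ((x :- y) :* (x :- y)) := (a :* (x :* x) :+ :- (y :+ y) :* (a :* x)) :+ y :* y :* a) refl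

      variance-identity : sumFin (λ v → sumFin (λ u → α v u * ((h u - m v) * (h u - m v)))) ≡
                          sumFin (λ u → h u * h u) - sumFin (λ v → m v * m v)
      variance-identity = begin
        sumFin (λ v → sumFin (λ u → α v u * ((h u - m v) * (h u - m v))))
          ≡⟨ sum-cong row-variance ⟩
        sumFin (λ v → average α (λ u → h u * h u) v - m v * m v)
          ≡⟨ sum-distrib-sub (average α (λ u → h u * h u)) (λ v → m v * m v) ⟩
        sumFin (average α (λ u → h u * h u)) - sumFin (λ v → m v * m v)
          ≡⟨ cong (_- sumFin (λ v → m v * m v)) (sum-average (λ u → h u * h u)) ⟩
        sumFin (λ u → h u * h u) - sumFin (λ v → m v * m v)
          ∎
        where open ≡-Reasoning

  -- Spread of a mean-zero function

  argmax : ∀ {k} → (Fin (suc k) → ℚ) → Fin (suc k)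
  argmax f = Extrema.argmax f zero (allFin _)

  ≤-argmax : ∀ {k} (f : Fin (suc k) → ℚ) u → f u ≤ f (argmax f)
  ≤-argmax f u = All.lookup (Extrema.f[xs]≤f[argmax] {f = f} zero (allFin _)) (∈-allFin u)

  argmin : ∀ {k} → (Fin (suc k) → ℚ) → Fin (suc k)
  argmin f = Extrema.argmin f zero (allFin _)

  argmin-≤ : ∀ {k} (f : Fin (suc k) → ℚ) u → f (argmin f) ≤ f u
  argmin-≤ f u = All.lookup (Extrema.f[argmin]≤f[xs] {f = f} zero (allFin _)) (∈-allFin u)

  -p*q≤[p-q]² : ∀ p q → - (p * q) ≤ (p - q) * (p - q)
  -p*q≤[p-q]² p q = 0≤q-p⇒p≤q (*-cancelˡ-≤-pos 2ℚ (subst₂ _≤_ (sym (*-zeroʳ 2ℚ)) twice 0≤sum-of-squares))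
    where
    2ℚ = 1ℚ + 1ℚ
    0≤sum-of-squares : 0ℚ ≤ (p - q) * (p - q) + (p * p + q * q)
    0≤sum-of-squares = +-mono-≤ (0≤p*p (p - q)) (+-mono-≤ (0≤p*p p) (0≤p*p q))
    twice : (p - q) * (p - q) + (p * p + q * q) ≡ 2ℚ * ((p - q) * (p - q) - - (p * q))
    twice = solve 2 (λ p q → (p :- q) :* (p :- q) :+ (p :* p :+ q :* q) :=
                             (con 1ℚ :+ con 1ℚ) :* ((p :- q) :* (p :- q) :- :- (p :* q))) refl p q

  sum-sq≤card*spread² : ∀ {k} (h : Fin k → ℚ) {a b} → sumFin h ≡ 0ℚ →
                        (∀ u → h u ≤ a) → (∀ u → b ≤ h u) →
                        sumFin (λ u → h u * h u) ≤ fromℕ k * ((a - b) * (a - b))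
  sum-sq≤card*spread² {k} h {a} {b} Σh≡0 h≤a b≤h =
    ≤-trans (0≤q-p⇒p≤q (subst (0ℚ ≤_) Σ[h-b][a-h]≡ (0≤sum 0≤[h-b][a-h]))) (*-monoˡ-≤-0≤ (0≤fromℕ k) (-p*q≤[p-q]² a b))
    where
    0≤[h-b][a-h] : ∀ u → 0ℚ ≤ (h u - b) * (a - h u)
    0≤[h-b][a-h] u = 0≤p*q (p≤q⇒0≤q-p (b≤h u)) (p≤q⇒0≤q-p (h≤a u))
    expand : ∀ x → (x - b) * (a - x) ≡ (a + b) * x - x * x + - (a * b)
    expand = solve 3 (λ a b x → (x :- b) :* (a :- x) := (a :+ b) :* x :- x :* x :+ :- (a :* b)) refl a b
    Σ[h-b][a-h]≡ : sumFin (λ u → (h u - b) * (a - h u)) ≡ fromℕ k * - (a * b) - sumFin (λ u → h u * h u)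
    Σ[h-b][a-h]≡ = begin
      sumFin (λ u → (h u - b) * (a - h u))
        ≡⟨ sum-cong (λ u → expand (h u)) ⟩
      sumFin (λ u → (a + b) * h u - h u * h u + - (a * b))
        ≡⟨ sum-distrib-+ (λ u → (a + b) * h u - h u * h u) (λ _ → - (a * b)) ⟩
      sumFin (λ u → (a + b) * h u - h u * h u) + sumFin {k} (λ _ → - (a * b))
        ≡⟨ cong₂ _+_ (sum-distrib-sub (λ u → (a + b) * h u) (λ u → h u * h u)) (sum-const {k} (- (a * b))) ⟩
      sumFin (λ u → (a + b) * h u) - sumFin (λ u → h u * h u) + fromℕ k * - (a * b)
        ≡⟨ cong (λ s → s - sumFin (λ u → h u * h u) + fromℕ k * - (a * b))
                (trans (sym (*-distribˡ-sum (a + b) h)) (trans (cong ((a + b) *_) Σh≡0) (*-zeroʳ (a + b)))) ⟩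
      0ℚ - sumFin (λ u → h u * h u) + fromℕ k * - (a * b)
        ≡⟨ solve 2 (λ s c → con 0ℚ :- s :+ c := c :- s) refl (sumFin (λ u → h u * h u)) (fromℕ k * - (a * b)) ⟩
      fromℕ k * - (a * b) - sumFin (λ u → h u * h u)
        ∎
      where open ≡-Reasoning

  cauchy-schwarz-step : ∀ n {σ t ρ} → σ * σ ≤ fromℕ (suc n) * ρ →
                        (σ + t) * (σ + t) ≤ fromℕ (suc (suc n)) * (ρ + t * t)
  cauchy-schwarz-step n {σ} {t} {ρ} σ²≤aρ =
    0≤q-p⇒p≤q (subst (0ℚ ≤_) (sym gap≡) (+-mono-≤ (p≤q⇒0≤q-p σ²≤aρ) 0≤Y))
    where
    a = fromℕ (suc n)
    Y = ρ + a * (t * t) - (σ * t + σ * t)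
    aY≡ : a * Y ≡ (a * ρ - σ * σ) + (σ - a * t) * (σ - a * t)
    aY≡ = solve 4 (λ a t ρ σ → a :* (ρ :+ a :* (t :* t) :- (σ :* t :+ σ :* t)) :=
                               (a :* ρ :- σ :* σ) :+ (σ :- a :* t) :* (σ :- a :* t)) refl a t ρ σ
    0≤Y : 0ℚ ≤ Y
    0≤Y = *-cancelˡ-≤-pos a {{positive (fromℕ-pos n)}}
            (subst₂ _≤_ (sym (*-zeroʳ a)) (sym aY≡) (+-mono-≤ (p≤q⇒0≤q-p σ²≤aρ) (0≤p*p (σ - a * t))))
    gap≡ : fromℕ (suc (suc n)) * (ρ + t * t) - (σ + t) * (σ + t) ≡ (a * ρ - σ * σ) + Y
    gap≡ = solve 4 (λ a t ρ σ → (con 1ℚ :+ a) :* (ρ :+ t :* t) :- (σ :+ t) :* (σ :+ t) :=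
                                (a :* ρ :- σ :* σ) :+ (ρ :+ a :* (t :* t) :- (σ :* t :+ σ :* t))) refl a t ρ σ

  -- Exploring an expander

  anyFin-true : ∀ {k} (f : Fin k → Bool) → anyFin f ≡ true → ∃ λ i → f i ≡ true
  anyFin-true {suc k} f any≡true with f zero in f0
  ... | true  = zero , f0
  ... | false with anyFin-true (λ i → f (suc i)) any≡true
  ...   | i , fi = suc i , fi

  module _ {k} (D : Digraph k) where

    ∈inNS⇒ : ∀ {S v} → v ∈ inNS D S → ∃ λ u → u ∈ S × adj D v u ≡ true
    ∈inNS⇒ {S} {v} v∈ with anyFin-true (λ u → lookup S u ∧ adj D v u)
                                         (trans (sym (lookup∘tabulate _ v)) ([]=⇒lookup v∈))
    ... | u , eq = u , lookup⇒[]= u S (∧-conicalˡ _ _ eq) , ∧-conicalʳ _ _ eq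

    ∈outNS⇒ : ∀ {T u} → u ∈ outNS D T → ∃ λ v → v ∈ T × adj D v u ≡ true
    ∈outNS⇒ {T} {u} u∈ with anyFin-true (λ v → lookup T v ∧ adj D v u)
                                          (trans (sym (lookup∘tabulate _ u)) ([]=⇒lookup u∈))
    ... | v , eq = v , lookup⇒[]= v T (∧-conicalˡ _ _ eq) , ∧-conicalʳ _ _ eq

    regular⇒in-neighbour : ∀ {d} → 1 ℕ.≤ d → Regular d D → ∀ u → ∃ λ v → adj D v u ≡ true
    regular⇒in-neighbour 1≤d reg u with nonempty? (inN D u)
    ... | yes (v , v∈) = v , trans (sym (lookup∘tabulate _ v)) ([]=⇒lookup v∈)
    ... | no  empty    = contradiction (subst (1 ℕ.≤_) ∣inN∣≡0 1≤d) λ ()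
      where
      ∣inN∣≡0 : _ ≡ 0
      ∣inN∣≡0 = trans (sym (proj₂ (reg u))) (trans (cong ∣_∣ (Empty-unique empty)) (∣⊥∣≡0 k))

    Crossing : Subset k → Subset k → Fin k → Fin k → Set
    Crossing T S v u = adj D v u ≡ true × (v ∉ T × u ∈ S ⊎ v ∈ T × u ∉ S)

    crossing? : ∀ T S v u → Dec (Crossing T S v u)
    crossing? T S v u = (adj D v u Bool.≟ true) ×-dec ((¬? (v ∈? T) ×-dec (u ∈? S)) ⊎-dec ((v ∈? T) ×-dec ¬? (u ∈? S)))

    module _ (exp : Expander D) (has-in-neighbour : ∀ u → ∃ λ v → adj D v u ≡ true) where

      no-crossing⇒⊥ : ∀ {T S p q} → p ∈ S → q ∉ S → (∀ v u → ¬ Crossing T S v u) → ⊥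
      no-crossing⇒⊥ {T} {S} {p} {q} p∈S q∉S no-crossing = T-proper-or-full (any? (λ v → ¬? (v ∈? T)))
        where
        into-T : ∀ {v u} → adj D v u ≡ true → u ∈ S → v ∈ T
        into-T {v} {u} e u∈S = decidable-stable (v ∈? T) (λ v∉T → no-crossing v u (e , inj₁ (v∉T , u∈S)))

        from-T : ∀ {v u} → adj D v u ≡ true → v ∈ T → u ∈ S
        from-T {v} {u} e v∈T = decidable-stable (u ∈? S) (λ u∉S → no-crossing v u (e , inj₂ (v∈T , u∉S)))

        inNS⊆T : inNS D S ⊆ T
        inNS⊆T v∈ with ∈inNS⇒ v∈
        ... | u , u∈S , e = into-T e u∈S

        outNS⊆S : outNS D T ⊆ S
        outNS⊆S u∈ with ∈outNS⇒ u∈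
        ... | v , v∈T , e = from-T e v∈T

        ∣S∣<∣T∣ : ∣ S ∣ ℕ.< ∣ T ∣
        ∣S∣<∣T∣ = ℕ.<-≤-trans (proj₁ (exp S (p , p∈S) (q , q∉S))) (p⊆q⇒∣p∣≤∣q∣ inNS⊆T)

        T-proper-or-full : Dec (∃ λ v → v ∉ T) → ⊥
        T-proper-or-full (yes v∉T) = ℕ.<-asym ∣S∣<∣T∣ (ℕ.<-≤-trans ∣T∣<∣outNS∣ (p⊆q⇒∣p∣≤∣q∣ outNS⊆S))
          where
          ∣T∣<∣outNS∣ : ∣ T ∣ ℕ.< ∣ outNS D T ∣
          ∣T∣<∣outNS∣ = proj₂ (exp T (_ , into-T (proj₂ (has-in-neighbour p)) p∈S) v∉T)
        T-proper-or-full (no T-full) with has-in-neighbour q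
        ... | v , e = q∉S (from-T e (decidable-stable (v ∈? T) (λ v∉T → T-full (v , v∉T))))

      crossing-edge : ∀ T S {p q} → p ∈ S → q ∉ S → ∃ λ v → ∃ λ u → Crossing T S v u
      crossing-edge T S p∈S q∉S with any? (λ v → any? (crossing? T S v))
      ... | yes found = found
      ... | no  none  = ⊥-elim (no-crossing⇒⊥ p∈S q∉S (λ v u c → none (v , u , c)))

  module Exploration {k} (D : Digraph k) (exp : Expander D) (has-in-neighbour : ∀ u → ∃ λ v → adj D v u ≡ true)
                     (h m : Fin k → ℚ) (p q : Fin k) where

    weight : Fin k → Fin k → ℚ
    weight v u = ind (adj D v u) * ((h u - m v) * (h u - m v))

    0≤weight : ∀ v u → 0ℚ ≤ weight v u
    0≤weight v u = 0≤p*q (0≤ind (adj D v u)) (0≤p*p (h u - m v))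

    weight-edge : ∀ {v u} → adj D v u ≡ true → weight v u ≡ ∣ h u - m v ∣ℚ * ∣ h u - m v ∣ℚ
    weight-edge {v} {u} e rewrite e = trans (*-identityˡ _) (sym (∣p∣*∣p∣≡p*p (h u - m v)))

    energy : Subset k → Subset k → ℚ
    energy T S = sumOver T (λ v → sumOver S (weight v))

    total-energy : ℚ
    total-energy = sumFin (λ v → sumFin (weight v))

    0≤energy : ∀ T S → 0ℚ ≤ energy T S
    0≤energy T S = 0≤sumOver (λ v → 0≤sumOver (0≤weight v) S) T

    energy≤total : ∀ T S → energy T S ≤ total-energy
    energy≤total T S = ≤-trans (sumOver≤sum (λ v → 0≤sumOver (0≤weight v) S) T)
                               (sum-mono-≤ (λ v → sumOver≤sum (0≤weight v) S))

    energy-∪⁅⁆ˡ : ∀ {T S v u} → v ∉ T → u ∈ S → energy T S + weight v u ≤ energy (T ∪ ⁅ v ⁆) S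
    energy-∪⁅⁆ˡ {T} {S} {v} {u} v∉T u∈S = subst (energy T S + weight v u ≤_) (sym (sumOver-∪⁅⁆ v∉T _))
      (+-monoʳ-≤ (energy T S) (term≤sumOver (0≤weight v) u∈S))

    energy-∪⁅⁆ʳ : ∀ {T S v u} → u ∉ S → v ∈ T → energy T S + weight v u ≤ energy T (S ∪ ⁅ u ⁆)
    energy-∪⁅⁆ʳ {T} {S} {v} {u} u∉S v∈T = subst (energy T S + weight v u ≤_) (sym energy≡)
      (+-monoʳ-≤ (energy T S) (term≤sumOver (λ v → 0≤weight v u) v∈T))
      where
      energy≡ : energy T (S ∪ ⁅ u ⁆) ≡ energy T S + sumOver T (λ v → weight v u)
      energy≡ = trans (sum-cong (λ v → cong (ind (lookup T v) *_) (sumOver-∪⁅⁆ u∉S (weight v))))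
                      (sumOver-distrib-+ T (λ v → sumOver S (weight v)) (λ v → weight v u))

    record Explored (n : ℕ) : Set where
      field
        S T      : Subset k
        σ        : ℚ
        p∈S      : p ∈ S
        S-within : ∀ {u} → u ∈ S → h p - h u ≤ σ
        T-within : ∀ {v} → v ∈ T → h p - m v ≤ σ
        σ²≤      : σ * σ ≤ fromℕ (suc n) * energy T S
        size     : suc n ℕ.≤ ∣ S ∣ ℕ.+ ∣ T ∣

    explored₀ : Explored 0
    explored₀ = record
      { S = ⁅ p ⁆ ; T = ∅ ; σ = 0ℚ
      ; p∈S      = x∈⁅x⁆ p
      ; S-within = λ u∈⁅p⁆ → ≤-reflexive (trans (cong (λ u → h p - h u) (x∈⁅y⁆⇒x≡y p u∈⁅p⁆)) (+-inverseʳ (h p)))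
      ; T-within = λ v∈∅ → contradiction v∈∅ ∉⊥
      ; σ²≤      = 0≤p*q (0≤fromℕ 1) (0≤energy ∅ ⁅ p ⁆)
      ; size     = subst (1 ℕ.≤_) (sym (cong (ℕ._+ ∣ ∅ {k} ∣) (∣⁅x⁆∣≡1 p))) (ℕ.s≤s ℕ.z≤n)
      }

    cauchy-schwarz-edge : ∀ {n σ v u E E′} → adj D v u ≡ true → σ * σ ≤ fromℕ (suc n) * E → E + weight v u ≤ E′ →
                          (σ + ∣ h u - m v ∣ℚ) * (σ + ∣ h u - m v ∣ℚ) ≤ fromℕ (suc (suc n)) * E′
    cauchy-schwarz-edge {n} {σ} {v} {u} {E} adj≡true σ²≤ E+w≤E′ = ≤-trans (cauchy-schwarz-step n {σ} {∣ h u - m v ∣ℚ} σ²≤)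
      (*-monoˡ-≤-0≤ (0≤fromℕ (suc (suc n))) (subst (λ w → E + w ≤ _) (weight-edge adj≡true) E+w≤E′))

    explore : ∀ {n} (e : Explored n) → q ∉ Explored.S e → Explored (suc n)
    explore {n} e q∉S with crossing-edge D exp has-in-neighbour T S p∈S q∉S
      where open Explored e
    ... | v , u , adj≡true , inj₁ (v∉T , u∈S) = record
      { S = S ; T = T ∪ ⁅ v ⁆ ; σ = σ + ∣ h u - m v ∣ℚ
      ; p∈S      = p∈S
      ; S-within = λ u′∈S → ≤-trans (S-within u′∈S) (p≤p+q (0≤∣p∣ (h u - m v)))
      ; T-within = T′-within
      ; σ²≤      = cauchy-schwarz-edge {n} {σ} adj≡true σ²≤ (energy-∪⁅⁆ˡ v∉T u∈S)
      ; size     = ℕ.≤-<-trans size (ℕ.+-monoʳ-< ∣ S ∣ (∣p∣<∣p∪⁅x⁆∣ v∉T))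
      }
      where
      open Explored e
      T′-within : ∀ {v′} → v′ ∈ T ∪ ⁅ v ⁆ → h p - m v′ ≤ σ + ∣ h u - m v ∣ℚ
      T′-within v′∈ with ∈∪⁅⁆⇒ v′∈
      ... | inj₁ v′∈T = ≤-trans (T-within v′∈T) (p≤p+q (0≤∣p∣ (h u - m v)))
      ... | inj₂ refl = subst (_≤ σ + ∣ h u - m v ∣ℚ) (telescope (h p) (h u) (m v))
                              (+-mono-≤ (S-within u∈S) (p≤∣p∣ (h u - m v)))
    ... | v , u , adj≡true , inj₂ (v∈T , u∉S) = record
      { S = S ∪ ⁅ u ⁆ ; T = T ; σ = σ + ∣ h u - m v ∣ℚ
      ; p∈S      = p⊆p∪q ⁅ u ⁆ p∈S
      ; S-within = S′-within
      ; T-within = λ v′∈T → ≤-trans (T-within v′∈T) (p≤p+q (0≤∣p∣ (h u - m v)))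
      ; σ²≤      = cauchy-schwarz-edge {n} {σ} adj≡true σ²≤ (energy-∪⁅⁆ʳ u∉S v∈T)
      ; size     = ℕ.≤-<-trans size (ℕ.+-monoˡ-< ∣ T ∣ (∣p∣<∣p∪⁅x⁆∣ u∉S))
      }
      where
      open Explored e
      S′-within : ∀ {u′} → u′ ∈ S ∪ ⁅ u ⁆ → h p - h u′ ≤ σ + ∣ h u - m v ∣ℚ
      S′-within u′∈ with ∈∪⁅⁆⇒ u′∈
      ... | inj₁ u′∈S = ≤-trans (S-within u′∈S) (p≤p+q (0≤∣p∣ (h u - m v)))
      ... | inj₂ refl = subst (_≤ σ + ∣ h u - m v ∣ℚ) (telescope (h p) (m v) (h u))
                              (+-mono-≤ (T-within v∈T) (subst (m v - h u ≤_) (∣q-p∣≡∣p-q∣ (h u) (m v)) (p≤∣p∣ (m v - h u))))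

    size≤k+k : ∀ {n} → Explored n → suc n ℕ.≤ k ℕ.+ k
    size≤k+k e = ℕ.≤-trans size (ℕ.+-mono-≤ (∣p∣≤n S) (∣p∣≤n T))
      where open Explored e

    search : ∀ fuel {n} → Explored n → k ℕ.+ k ℕ.≤ fuel ℕ.+ n → h q ≤ h p →
             (h p - h q) * (h p - h q) ≤ fromℕ (k ℕ.+ k) * total-energy
    search fuel e budget hq≤hp with q ∈? Explored.S e
    ... | yes q∈S = ≤-trans (p≤q⇒p*p≤q*q (p≤q⇒0≤q-p hq≤hp) (S-within q∈S)) (≤-trans σ²≤
                      (*-mono-≤-0≤ (0≤fromℕ (k ℕ.+ k)) (0≤energy T S) (fromℕ-mono-≤ (size≤k+k e)) (energy≤total T S)))
      where open Explored e
    search zero e budget _ | no q∉S =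
      ⊥-elim (ℕ.<-irrefl refl (ℕ.≤-trans (size≤k+k e) budget))
    search (suc fuel) {n} e budget hq≤hp | no q∉S =
      search fuel (explore e q∉S) (subst (k ℕ.+ k ℕ.≤_) (sym (ℕ.+-suc fuel n)) budget) hq≤hp

    descent-bound : h q ≤ h p → (h p - h q) * (h p - h q) ≤ fromℕ (k ℕ.+ k) * total-energy
    descent-bound = search (k ℕ.+ k) explored₀ (ℕ.m≤m+n (k ℕ.+ k) 0)

  -- One step of the walk

  transition : ∀ {k} → Digraph k → Fin k → Fin k → ℚ
  transition D v u = ind (adj D v u) * inv ∣ outN D v ∣

  transpose : ∀ {k} → Digraph k → Digraph k
  transpose D = record { adj = λ u v → adj D v u ; noLoop = noLoop D }

  regular-transpose : ∀ {k d} {D : Digraph k} → Regular d D → Regular d (transpose D)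
  regular-transpose reg v = swap (reg v)

  expander-transpose : ∀ {k} {D : Digraph k} → Expander D → Expander (transpose D)
  expander-transpose exp S nonempty proper = swap (exp S nonempty proper)

  module _ {k} (D : Digraph k) {d} (1≤d : 1 ℕ.≤ d) (reg : Regular d D) where

    private instance
      d≢0 : ℕ.NonZero d
      d≢0 = ℕ.>-nonZero 1≤d

    transition≡ : ∀ v u → transition D v u ≡ ind (adj D v u) * inv d
    transition≡ v u = cong (λ n → ind (adj D v u) * inv n) (proj₁ (reg v))

    transition-rowSum : ∀ v → sumFin (transition D v) ≡ 1ℚ
    transition-rowSum v = begin
      sumFin (λ u → ind (adj D v u) * inv ∣ outN D v ∣) ≡⟨ sym (*-distribʳ-sum (inv ∣ outN D v ∣) (λ u → ind (adj D v u))) ⟩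
      sumFin (λ u → ind (adj D v u)) * inv ∣ outN D v ∣ ≡⟨ cong (_* inv ∣ outN D v ∣) (sum-ind (adj D v)) ⟩
      fromℕ ∣ outN D v ∣ * inv ∣ outN D v ∣              ≡⟨ cong (λ n → fromℕ n * inv n) (proj₁ (reg v)) ⟩
      fromℕ d * inv d                                    ≡⟨ fromℕ*inv d ⟩
      1ℚ                                                 ∎
      where open ≡-Reasoning

    transition-colSum : ∀ u → sumFin (λ v → transition D v u) ≡ 1ℚ
    transition-colSum u = begin
      sumFin (λ v → transition D v u)         ≡⟨ sum-cong (λ v → transition≡ v u) ⟩
      sumFin (λ v → ind (adj D v u) * inv d)  ≡⟨ sym (*-distribʳ-sum (inv d) (λ v → ind (adj D v u))) ⟩
      sumFin (λ v → ind (adj D v u)) * inv d  ≡⟨ cong (_* inv d) (sum-ind (λ v → adj D v u)) ⟩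
      fromℕ ∣ inN D u ∣ * inv d               ≡⟨ cong (λ n → fromℕ n * inv d) (proj₂ (reg u)) ⟩
      fromℕ d * inv d                         ≡⟨ fromℕ*inv d ⟩
      1ℚ                                      ∎
      where open ≡-Reasoning

  module _ {k} (D : Digraph (suc k)) {d} (1≤d : 1 ℕ.≤ d) (reg : Regular d D) (exp : Expander D) where

    private instance
      d≢0 : ℕ.NonZero d
      d≢0 = ℕ.>-nonZero 1≤d

    open DoublyStochastic (transition D) (transition-rowSum D 1≤d reg) (transition-colSum D 1≤d reg)

    private
      K : ℕ
      K = 2 ℕ.* suc k ℕ.^ 3

      d≤k : d ℕ.≤ suc k
      d≤k = subst (ℕ._≤ suc k) (proj₁ (reg zero)) (∣p∣≤n (outN D zero))

      k[k+k]d≤K : suc k ℕ.* (suc k ℕ.+ suc k) ℕ.* d ℕ.≤ K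
      k[k+k]d≤K = ℕ.≤-trans (ℕ.*-monoʳ-≤ (suc k ℕ.* (suc k ℕ.+ suc k)) d≤k) (ℕ.≤-reflexive (cube (suc k)))
        where
        cube : ∀ n → n ℕ.* (n ℕ.+ n) ℕ.* n ≡ 2 ℕ.* n ℕ.^ 3
        cube = S.solve 1 (λ n → n S.:* (n S.:+ n) S.:* n S.:= S.con 2 S.:* (n S.:^ 3)) refl
          where module S = ℕ-Solver.+-*-Solver

    average-contracts : ∀ h → sumFin h ≡ 0ℚ →
                        sumFin (λ v → average (transition D) h v * average (transition D) h v) ≤
                        (1ℚ - inv (2 ℕ.* suc k ℕ.^ 3)) * sumFin (λ u → h u * h u)
    average-contracts h Σh≡0 = 0≤q-p⇒p≤q (subst (0ℚ ≤_) rearrange (p≤q⇒0≤q-p ε∑h²≤variance))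
      where
      g = average (transition D) h
      Σh² = sumFin (λ u → h u * h u)
      Σg² = sumFin (λ v → g v * g v)
      p = argmax h
      q = argmin h
      open Exploration D exp (regular⇒in-neighbour D 1≤d reg) h g p q

      variance : ℚ
      variance = sumFin (λ v → sumFin (λ u → transition D v u * ((h u - g v) * (h u - g v))))

      variance≡ : variance ≡ inv d * total-energy
      variance≡ = trans (sum-cong (λ v → trans (sum-cong (λ u → pull-out v u)) (sym (*-distribˡ-sum (inv d) (weight v)))))
                        (sym (*-distribˡ-sum (inv d) (λ v → sumFin (weight v))))
        where
        pull-out : ∀ v u → transition D v u * ((h u - g v) * (h u - g v)) ≡ inv d * weight v u
        pull-out v u = trans (cong (_* ((h u - g v) * (h u - g v))) (transition≡ D 1≤d reg v u))
                             (solve 3 (λ a i x → a :* i :* x := i :* (a :* x)) refl (ind (adj D v u)) (inv d) ((h u - g v) * (h u - g v)))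

      ε∑h²≤variance : inv K * Σh² ≤ variance
      ε∑h²≤variance = begin
        inv K * Σh²
          ≤⟨ *-monoˡ-≤-0≤ (0≤inv K) (sum-sq≤card*spread² h Σh≡0 (≤-argmax h) (argmin-≤ h)) ⟩
        inv K * (fromℕ (suc k) * ((h p - h q) * (h p - h q)))
          ≤⟨ *-monoˡ-≤-0≤ (0≤inv K) (*-monoˡ-≤-0≤ (0≤fromℕ (suc k)) (descent-bound (argmin-≤ h p))) ⟩
        inv K * (fromℕ (suc k) * (fromℕ (suc k ℕ.+ suc k) * total-energy))
          ≡⟨ cong (inv K *_) (sym (*-assoc (fromℕ (suc k)) (fromℕ (suc k ℕ.+ suc k)) total-energy)) ⟩
        inv K * (fromℕ (suc k) * fromℕ (suc k ℕ.+ suc k) * total-energy)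
          ≡⟨ sym (*-assoc (inv K) _ total-energy) ⟩
        inv K * (fromℕ (suc k) * fromℕ (suc k ℕ.+ suc k)) * total-energy
          ≡⟨ cong (λ z → inv K * z * total-energy) (sym (fromℕ-* (suc k) (suc k ℕ.+ suc k))) ⟩
        inv K * fromℕ (suc k ℕ.* (suc k ℕ.+ suc k)) * total-energy
          ≤⟨ *-monoʳ-≤-0≤ (0≤sum (λ v → 0≤sum (0≤weight v))) (m*d≤K⇒m/K≤1/d {suc k ℕ.* (suc k ℕ.+ suc k)} k[k+k]d≤K) ⟩
        inv d * total-energy
          ≡⟨ sym variance≡ ⟩
        variance
          ∎
        where open ≤-Reasoning

      rearrange : variance - inv K * Σh² ≡ (1ℚ - inv K) * Σh² - Σg²
      rearrange = trans (cong (_- inv K * Σh²) (variance-identity h))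
                        (solve 3 (λ s t e → s :- t :- e :* s := (con 1ℚ :- e) :* s :- t) refl Σh² Σg² (inv K))

    deviation-contracts : ∀ f c → sumFin (λ u → f u - c) ≡ 0ℚ →
      (sumFin (λ v → average (transition D) f v - c) ≡ 0ℚ) ×
      (sumFin (λ v → (average (transition D) f v - c) * (average (transition D) f v - c)) ≤
       (1ℚ - inv (2 ℕ.* suc k ℕ.^ 3)) * sumFin (λ u → (f u - c) * (f u - c)))
    deviation-contracts f c Σh≡0 =
      trans (sum-cong shift) (trans (sum-average h) Σh≡0) ,
      subst (_≤ _) (sym (sum-cong (λ v → cong₂ _*_ (shift v) (shift v)))) (average-contracts h Σh≡0)
      where
      h = λ u → f u - c
      shift : ∀ v → average (transition D) f v - c ≡ average (transition D) h v
      shift v = sym (average-shift f c v)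

  -- Random P-walks

  module _ {k} (x : Fin k) {c} (kc≡1 : fromℕ k * c ≡ 1ℚ) where

    sum-δ≡1 : sumFin (λ u → δ u x) ≡ 1ℚ
    sum-δ≡1 = trans (sum-cong (λ u → sym (*-identityʳ (δ u x)))) (sum-δ x (λ _ → 1ℚ))

    sum-δ-deviation : sumFin (λ u → δ u x - c) ≡ 0ℚ
    sum-δ-deviation = begin
      sumFin (λ u → δ u x - c)                 ≡⟨ sum-distrib-sub (λ u → δ u x) (λ _ → c) ⟩
      sumFin (λ u → δ u x) - sumFin {k} (λ _ → c) ≡⟨ cong₂ _-_ sum-δ≡1 (trans (sum-const {k} c) kc≡1) ⟩
      1ℚ - 1ℚ                                  ≡⟨ +-inverseʳ 1ℚ ⟩
      0ℚ                                       ∎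
      where open ≡-Reasoning

    sum-δ-deviation² : 0ℚ ≤ c → sumFin (λ u → (δ u x - c) * (δ u x - c)) ≤ 1ℚ
    sum-δ-deviation² 0≤c = 0≤q-p⇒p≤q (subst (0ℚ ≤_) (sym 1-Σ≡c) 0≤c)
      where
      pointwise : ∀ u → (δ u x - c) * (δ u x - c) ≡ δ u x * (1ℚ - (c + c)) + c * c
      pointwise u = begin
        (δ u x - c) * (δ u x - c)              ≡⟨ solve 2 (λ a c → (a :- c) :* (a :- c) := a :* a :- a :* (c :+ c) :+ c :* c) refl (δ u x) c ⟩
        δ u x * δ u x - δ u x * (c + c) + c * c ≡⟨ cong (λ a → a - δ u x * (c + c) + c * c) (δ-idem u x) ⟩
        δ u x - δ u x * (c + c) + c * c         ≡⟨ solve 2 (λ a c → a :- a :* (c :+ c) :+ c :* c := a :* (con 1ℚ :- (c :+ c)) :+ c :* c) refl (δ u x) c ⟩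
        δ u x * (1ℚ - (c + c)) + c * c          ∎
        where open ≡-Reasoning
      1-Σ≡c : 1ℚ - sumFin (λ u → (δ u x - c) * (δ u x - c)) ≡ c
      1-Σ≡c = begin
        1ℚ - sumFin (λ u → (δ u x - c) * (δ u x - c))
          ≡⟨ cong (λ s → 1ℚ - s) (trans (sum-cong pointwise) (sum-distrib-+ (λ u → δ u x * (1ℚ - (c + c))) (λ _ → c * c))) ⟩
        1ℚ - (sumFin (λ u → δ u x * (1ℚ - (c + c))) + sumFin {k} (λ _ → c * c))
          ≡⟨ cong₂ (λ s t → 1ℚ - (s + t)) (trans (sym (*-distribʳ-sum (1ℚ - (c + c)) (λ u → δ u x))) (cong (_* (1ℚ - (c + c))) sum-δ≡1))
                                           (trans (sum-const {k} (c * c)) (trans (sym (*-assoc (fromℕ k) c c)) (cong (_* c) kc≡1))) ⟩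
        1ℚ - (1ℚ * (1ℚ - (c + c)) + 1ℚ * c)
          ≡⟨ solve 1 (λ c → con 1ℚ :- (con 1ℚ :* (con 1ℚ :- (c :+ c)) :+ con 1ℚ :* c) := c) refl c ⟩
        c ∎
        where open ≡-Reasoning

  module _ {k} (D : Digraph (suc k)) {d} (1≤d : 1 ℕ.≤ d) (reg : Regular d D) (exp : Expander D) (x : Fin (suc k)) where

    private
      c = inv (suc k)
      r = 1ℚ - inv (2 ℕ.* suc k ℕ.^ 3)

      contract : ∀ {A : Set} {n s s′} → A × s′ ≤ r * s → s ≤ r ^ℚ n → A × s′ ≤ r ^ℚ suc n
      contract (a , s′≤rs) s≤rⁿ = a , ≤-trans s′≤rs (*-monoˡ-≤-0≤ (p≤q⇒0≤q-p (inv≤1 (2 ℕ.* suc k ℕ.^ 3))) s≤rⁿ)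

    walk-deviation : ∀ {n} (P : OrientedPath n) →
      (sumFin (λ u → walkProb D P u x - c) ≡ 0ℚ) ×
      (sumFin (λ u → (walkProb D P u x - c) * (walkProb D P u x - c)) ≤ r ^ℚ n)
    walk-deviation []                = sum-δ-deviation x (fromℕ*inv (suc k)) , sum-δ-deviation² x (fromℕ*inv (suc k)) (0≤inv (suc k))
    walk-deviation {suc n} (true ∷ P)  = contract {n = n}
      (deviation-contracts D 1≤d reg exp (λ u → walkProb D P u x) c (proj₁ (walk-deviation P))) (proj₂ (walk-deviation P))
    -- A backward step is, definitionally, a forward step in the transpose.
    walk-deviation {suc n} (false ∷ P) = contract {n = n}
      (deviation-contracts (transpose D) 1≤d (regular-transpose {D = D} reg) (expander-transpose {D = D} exp)
                           (λ u → walkProb D P u x) c (proj₁ (walk-deviation P)))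
      (proj₂ (walk-deviation P))

open import Defs
open import Data.Nat using (ℕ; _≤_; _*_; _^_)
open import Data.Fin using (Fin)
open import Data.Rational using (ℚ; 1ℚ) renaming (_≤_ to _≤ℚ_; _*_ to _*ℚ_; _-_ to _-ℚ_)
open import Data.Nat using (zero; suc)
open import Data.Product using (proj₂)
open import Data.Rational.Properties using (≤-trans)

lemma2p22 : (k d n : ℕ) (D : Digraph k) → 1 ≤ d → Regular d D → Expander D →
    (P : OrientedPath n) (v x : Fin k) →
    let e = walkProb D P v x -ℚ inv k in
    e *ℚ e ≤ℚ (1ℚ -ℚ inv (2 * k ^ 3)) ^ℚ n
lemma2p22 zero    d n D 1≤d reg exp P () x
lemma2p22 (suc k) d n D 1≤d reg exp P v x =
  ≤-trans (term≤sum (λ u → 0≤p*p (walkProb D P u x -ℚ inv (suc k))) v)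
          (proj₂ (walk-deviation D 1≤d reg exp x P))
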